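{- For all integers $r\ge 2$ and $k\ge 3$, $\mathcal M_{2,k}^{r+2}\to\mathcal M_{2,k}^r$.
   Context: $\mathbf{LO}_k^r$ is the $r$-ary structure with domain $[k]=\{1,\dots,k\}$ and relation consisting of all tuples in $[k]^r$ with a unique maximum. For $r$-ary structures $\mathbf{A},\mathbf{B}$, a $p$-ary polymorphism is a function $f: A^p\to B$ such that whenever an $r\times p$ matrix has every column in the relation of $\mathbf A$, applying $f$ to each row yields a tuple in the relation of $\mathbf B$. $\mathrm{Pol}(\mathbf A,\mathbf B)$ is the minion of all polymorphisms with minors $f_\pi(x_1,\dots,x_q)=f(x_{\pi(1)},\dots,x_{\pi(p)})$ for $\pi:[p]\to[q]$. $\mathcal{M}_{2,k}^r = \mathrm{Pol}(\mathbf{LO}_2^r,\mathbf{LO}_k^r)$. A minion homomorphism $\xi:\mathcal M\to\mathcal N$ maps $p$-ary elements to $p$-ary elements with $\xi(f)_\pi=\xi(f_\pi)$ for all $\pi,f$; $\mathcal M\to\mathcal N$ means one exists. -}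

module Defs where

open import Data.Nat using (ℕ)
open import Data.Fin using (Fin; _<_)
open import Data.Product using (Σ; _,_; proj₁; proj₂)
open import Relation.Binary.PropositionalEquality using (_≡_)
open import Relation.Nullary using (¬_)

LO : (k r : ℕ) → (Fin r → Fin k) → Set
LO k r t = Σ (Fin r) λ i → ∀ j → ¬ (j ≡ i) → t j < t i

-- p-ary polymorphisms from LO_2^r to LO_k^r.
-- A matrix is M : Fin r → Fin p → Fin 2 (rows indexed by Fin r, columns by Fin p).
IsPol : (r k p : ℕ) → ((Fin p → Fin 2) → Fin k) → Set
IsPol r k p f =
  (M : Fin r → Fin p → Fin 2) →
  (∀ c → LO 2 r (λ i → M i c)) →
  LO k r (λ i → f (M i))

-- p-ary elements of the minion M^r_{2,k} = Pol(LO_2^r, LO_k^r)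
Pol : (r k p : ℕ) → Set
Pol r k p = Σ ((Fin p → Fin 2) → Fin k) (IsPol r k p)

minorFun : {k p q : ℕ} → (Fin p → Fin q) → ((Fin p → Fin 2) → Fin k) → (Fin q → Fin 2) → Fin k
minorFun π f x = f (λ c → x (π c))

minorIsPol : {r k p q : ℕ} (π : Fin p → Fin q) (f : (Fin p → Fin 2) → Fin k) →
             IsPol r k p f → IsPol r k q (minorFun π f)
minorIsPol π f pf M cols = pf (λ i c → M i (π c)) (λ c → cols (π c))

minor : {r k p q : ℕ} → (Fin p → Fin q) → Pol r k p → Pol r k q
minor π (f , pf) = minorFun π f , minorIsPol π f pf

_≈P_ : {r k p : ℕ} → Pol r k p → Pol r k p → Set
f ≈P g = ∀ x → proj₁ f x ≡ proj₁ g x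

record MinionHom (r s k : ℕ) : Set where
  field
    map      : ∀ {p} → Pol r k p → Pol s k p
    map-resp : ∀ {p} (f g : Pol r k p) → f ≈P g → map f ≈P map g
    map-minor : ∀ {p q} (π : Fin p → Fin q) (f : Pol r k p) →
                map (minor π f) ≈P minor π (map f)

{-# OPTIONS --safe #-}
module Submission where

-- Every polymorphism of arity r + 2 is already one of arity r, so the identity on functions is the
-- minion homomorphism.  Given an r-row matrix whose columns have a unique maximum, append two zero
-- rows: since r ≥ 2 each column maximum is 1, so the padded columns still have a unique maximum.
-- The output on the padded matrix then has a unique maximum, which cannot sit on the two equal
-- padded rows, hence lies among the original rows and remains a unique maximum there.

open import Defs
open import Data.Nat using (ℕ; _≤_; _+_; s≤s; z≤n) renaming (suc to 1+)
open import Data.Nat.Properties using (≤-refl; ≤-<-trans)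
open import Data.Fin using (Fin; zero; suc; splitAt; _↑ˡ_; _↑ʳ_; _<_)
open import Data.Fin.Properties
  using (_≟_; <-irrefl; ↑ˡ-injective; ↑ʳ-injective; splitAt-↑ˡ; splitAt-↑ʳ; splitAt⁻¹-↑ˡ; splitAt⁻¹-↑ʳ)
open import Data.Sum using (_⊎_; inj₁; inj₂; [_,_]′)
open import Data.Product using (∃; _,_)
open import Function using (_∘_; _$_; const)
open import Relation.Binary.PropositionalEquality
  using (_≡_; _≢_; _≗_; refl; sym; trans; cong; subst₂)
open import Relation.Nullary using (yes; no; contradiction)

Fin-≢ : ∀ {n} → 2 ≤ n → (i : Fin n) → ∃ λ j → j ≢ i
Fin-≢ (s≤s (s≤s _)) zero    = suc zero , λ ()
Fin-≢ (s≤s (s≤s _)) (suc i) = zero , λ ()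

↑ˡ-or-↑ʳ : ∀ {m n} (i : Fin (m + n)) → (∃ λ j → j ↑ˡ n ≡ i) ⊎ (∃ λ x → m ↑ʳ x ≡ i)
↑ˡ-or-↑ʳ {m} i with splitAt m i in eq
... | inj₁ j = inj₁ (j , splitAt⁻¹-↑ˡ eq)
... | inj₂ x = inj₂ (x , splitAt⁻¹-↑ʳ eq)

IsStrictMax : ∀ {k r} → (Fin r → Fin k) → Fin r → Set
IsStrictMax t i = ∀ j → j ≢ i → t j < t i

strictMax-unique : ∀ {k r} {t : Fin r → Fin k} {i} → IsStrictMax t i → ∀ j → t j ≡ t i → j ≡ i
strictMax-unique {i = i} max j tj≡ti with j ≟ i
... | yes j≡i = j≡i
... | no  j≢i = contradiction (max j j≢i) (<-irrefl tj≡ti)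

LO-resp-≗ : ∀ {k r} {s t : Fin r → Fin k} → s ≗ t → LO k r s → LO k r t
LO-resp-≗ s≗t (i , max) = i , λ j j≢i → subst₂ _<_ (s≗t j) (s≗t i) (max j j≢i)

zero<strictMax : ∀ {k r} {t : Fin r → Fin (1+ k)} {i} → 2 ≤ r → IsStrictMax t i → zero {k} < t i
zero<strictMax {i = i} 2≤r max with Fin-≢ 2≤r i
... | j , j≢i = ≤-<-trans z≤n (max j j≢i)

LO-pad : ∀ {k m n} {s : Fin m → Fin (1+ k)} {t : Fin (m + n) → Fin (1+ k)} → 2 ≤ m →
         (∀ j → t (j ↑ˡ n) ≡ s j) → (∀ x → t (m ↑ʳ x) ≡ zero) →
         LO (1+ k) m s → LO (1+ k) (m + n) t
LO-pad {m = m} {n} {t = t} 2≤m t↑ˡ t↑ʳ (i , max) = i ↑ˡ n , padMax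
  where
  padMax : IsStrictMax t (i ↑ˡ n)
  padMax j j≢ with ↑ˡ-or-↑ʳ {m} {n} j
  ... | inj₁ (j′ , refl) =
    subst₂ _<_ (sym (t↑ˡ j′)) (sym (t↑ˡ i)) (max j′ (j≢ ∘ cong (_↑ˡ n)))
  ... | inj₂ (x , refl) =
    subst₂ _<_ (sym (t↑ʳ x)) (sym (t↑ˡ i)) (zero<strictMax 2≤m max)

LO-unpad : ∀ {k m n} {s : Fin m → Fin k} {t : Fin (m + n) → Fin k} → 2 ≤ n →
           (∀ j → t (j ↑ˡ n) ≡ s j) → (∀ x y → t (m ↑ʳ x) ≡ t (m ↑ʳ y)) →
           LO k (m + n) t → LO k m s
LO-unpad {m = m} {n} 2≤n t↑ˡ t↑ʳ (i , max) with ↑ˡ-or-↑ʳ {m} {n} i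
... | inj₁ (i′ , refl) =
  LO-resp-≗ t↑ˡ (i′ , λ j j≢i′ → max (j ↑ˡ n) (j≢i′ ∘ ↑ˡ-injective n j i′))
... | inj₂ (x , refl) with Fin-≢ 2≤n x
... | y , y≢x =
  contradiction (↑ʳ-injective m y x (strictMax-unique max (m ↑ʳ y) (t↑ʳ y x))) y≢x

padRows : ∀ {r p} n → (Fin r → Fin p → Fin 2) → Fin (r + n) → Fin p → Fin 2
padRows {r} n M i = [ M , const (const zero) ]′ (splitAt r i)

padRows-↑ˡ : ∀ {r p} n (M : Fin r → Fin p → Fin 2) j → padRows n M (j ↑ˡ n) ≡ M j
padRows-↑ˡ {r} n M j = cong [ M , const (const zero) ]′ (splitAt-↑ˡ r j n)

padRows-↑ʳ : ∀ {r p} n (M : Fin r → Fin p → Fin 2) x → padRows n M (r ↑ʳ x) ≡ const zero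
padRows-↑ʳ {r} n M x = cong [ M , const (const zero) ]′ (splitAt-↑ʳ r n x)

IsPol-restrict : ∀ {r k p} n → 2 ≤ r → 2 ≤ n → (f : (Fin p → Fin 2) → Fin k) →
                 IsPol (r + n) k p f → IsPol r k p f
IsPol-restrict {r} n 2≤r 2≤n f pol M cols =
  LO-unpad 2≤n (cong f ∘ padRows-↑ˡ n M) equalPadRows (pol (padRows n M) paddedCols)
  where
  equalPadRows : ∀ x y → f (padRows n M (r ↑ʳ x)) ≡ f (padRows n M (r ↑ʳ y))
  equalPadRows x y = cong f (trans (padRows-↑ʳ n M x) (sym (padRows-↑ʳ n M y)))

  paddedCols : ∀ c → LO 2 (r + n) (λ i → padRows n M i c)
  paddedCols c = LO-pad 2≤r (λ j → cong (_$ c) (padRows-↑ˡ n M j))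
                            (λ x → cong (_$ c) (padRows-↑ʳ n M x)) (cols c)

inclusionHom : ∀ {r s k} → (∀ {p} (f : (Fin p → Fin 2) → Fin k) → IsPol s k p f → IsPol r k p f) →
               MinionHom s r k
inclusionHom restrict = record
  { map       = λ { (f , pol) → f , restrict f pol }
  ; map-resp  = λ _ _ f≈g → f≈g
  ; map-minor = λ _ _ _ → refl
  }

theorem5p20 : (r k : ℕ) → 2 ≤ r → 3 ≤ k → MinionHom (r + 2) r k
-- The construction works for every k.
theorem5p20 r k 2≤r _ = inclusionHom (IsPol-restrict 2 2≤r ≤-refl)
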